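{- For every poset $L$, the presheaf $\langle L\rangle$ on $\mathbf{Kp}$ given by $\langle L\rangle(P)=\mathbf{Pos}(P,L)$ belongs to $\mathbf{IKp}\subseteq\mathcal K$, and the resulting functor $\langle-\rangle:\mathbf{Pos}\to\mathbf{IKp}$ is right adjoint to the inclusion functor $\mathbf{IKp}\rightarrowtail\mathbf{Pos}$.
   Context: $\mathbf{Pos}$ is the category of posets and monotone maps. $\mathbf{Kp}$ is the category of finite posets and open maps (monotone $f:P\to Q$ such that $f(p)\le q$ implies there is $p'\ge p$ with $f(p')=q$); $J$ is the Grothendieck topology on $\mathbf{Kp}$ whose covering sieves are the jointly surjective ones; $\mathcal K=\mathbf{Sh}(\mathbf{Kp},J)$. $\mathbf{IKp}$ is the category of image finite posets (each ${\uparrow}x$ finite) and open maps; it is the ind-completion of $\mathbf{Kp}$ and is identified with the full subcategory of $\mathcal K$ of sheaves $\mathbf{Kp}^{\mathrm{op}}\to\mathbf{Set}$ preserving finite limits, via $X\mapsto\mathbf{IKp}(-,X)|_{\mathbf{Kp}}$. The inclusion $\mathbf{IKp}\rightarrowtail\mathbf{Pos}$ is the (non-full) forgetful inclusion. -}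

module Defs where

open import Level using (Level; _⊔_)
open import Data.Product using (Σ; ∃; _×_; _,_)
open import Data.List using (List)
open import Data.List.Relation.Unary.Any using (Any)
open import Data.List.Relation.Unary.All using (All)
open import Relation.Binary.Bundles using (Poset)
open import Relation.Binary.Morphism.Structures using (IsOrderHomomorphism)

private
  variable
    a b ℓ ℓ' ℓ₂ ℓ₂' : Level

record Monotone (P : Poset a ℓ ℓ₂) (Q : Poset b ℓ' ℓ₂')
       : Set (a ⊔ b ⊔ ℓ ⊔ ℓ' ⊔ ℓ₂ ⊔ ℓ₂') where
  private
    module P = Poset P
    module Q = Poset Q
  field
    fun          : P.Carrier → Q.Carrier
    isMonotone   : IsOrderHomomorphism P._≈_ Q._≈_ P._≤_ Q._≤_ fun
open Monotone public

-- Open maps (morphisms of Kp / IKp): monotone f such that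
-- f p ≤ q implies there is p' ≥ p with f p' = q.
record OpenMap (P : Poset a ℓ ℓ₂) (Q : Poset b ℓ' ℓ₂')
       : Set (a ⊔ b ⊔ ℓ ⊔ ℓ' ⊔ ℓ₂ ⊔ ℓ₂') where
  private
    module P = Poset P
    module Q = Poset Q
  field
    monotone : Monotone P Q
  field
    isOpen   : ∀ p q → Q._≤_ (Monotone.fun monotone p) q →
               Σ P.Carrier (λ p' → P._≤_ p p' × Q._≈_ (Monotone.fun monotone p') q)
open OpenMap public using (monotone; isOpen)

underlying : {P : Poset a ℓ ℓ₂} {Q : Poset b ℓ' ℓ₂'} → OpenMap P Q → Monotone P Q
underlying = OpenMap.monotone

FiniteUpset : (P : Poset a ℓ ℓ₂) → Poset.Carrier P → Set (a ⊔ ℓ ⊔ ℓ₂)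
FiniteUpset P x =
  Σ (List Carrier) λ xs → All (x ≤_) xs × (∀ y → x ≤ y → Any (y ≈_) xs)
  where open Poset P

ImageFinite : Poset a ℓ ℓ₂ → Set (a ⊔ ℓ ⊔ ℓ₂)
ImageFinite P = ∀ x → FiniteUpset P x

_∘M_ : {P : Poset a ℓ ℓ₂} {Q : Poset b ℓ' ℓ₂'} {c ℓ'' ℓ₂'' : Level}
       {R : Poset c ℓ'' ℓ₂''} → Monotone Q R → Monotone P Q → Monotone P R
_∘M_ {P = P} {Q} {R = R} g f = record
  { fun = λ x → fun g (fun f x)
  ; isMonotone = record
      { cong = λ e → IsOrderHomomorphism.cong (isMonotone g) (IsOrderHomomorphism.cong (isMonotone f) e)
      ; mono = λ e → IsOrderHomomorphism.mono (isMonotone g) (IsOrderHomomorphism.mono (isMonotone f) e) } }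

_≗M_ : {P : Poset a ℓ ℓ₂} {Q : Poset b ℓ' ℓ₂'} → Monotone P Q → Monotone P Q → Set (a ⊔ ℓ')
_≗M_ {P = P} {Q = Q} f g = ∀ x → Poset._≈_ Q (fun f x) (fun g x)

-- The inclusion IKp ↣ Pos has a right adjoint ⟨-⟩, witnessed pointwise by a
-- universal arrow (couniversal from the inclusion to L): an image-finite ⟨L⟩
-- with a monotone counit ε : ⟨L⟩ → L such that every monotone f : X → L
-- from an image-finite X factors as ε ∘ g for a unique open g : X → ⟨L⟩.
-- (Taking X finite gives ⟨L⟩(P) = IKp(P,⟨L⟩) ≅ Pos(P,L).)
record CouniversalArrow (a : Level) (L : Poset a a a) : Set (Level.suc a) where
  field
    ⟨L⟩        : Poset a a a
    imageFinite : ImageFinite ⟨L⟩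
    counit      : Monotone ⟨L⟩ L
    factor      : (X : Poset a a a) → ImageFinite X → (f : Monotone X L) →
                  Σ (OpenMap X ⟨L⟩) λ g → (counit ∘M underlying g) ≗M f
    unique      : (X : Poset a a a) → ImageFinite X → (f : Monotone X L) →
                  (g h : OpenMap X ⟨L⟩) →
                  (counit ∘M underlying g) ≗M f → (counit ∘M underlying h) ≗M f →
                  underlying g ≗M underlying h

-- ⟨L⟩ is built from finite rooted frames labelled in L. A point is a finite
-- set of nodes whose successor lists are reflexive and transitive up to
-- bisimilarity and along which labels increase; points are identified when
-- their roots are bisimilar, and e ≤ e' when some successor of the root of e
-- is bisimilar to the root of e'. The successors of the root enumerate ↑e, so
-- ⟨L⟩ is image finite, and the counit reads off the root label.
--
-- A monotone f : X → L on an image-finite X factors through the open map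
-- sending x to the finite frame ↑x labelled by f. An open map g over f is
-- determined to every depth by induction: openness realises each successor
-- of the root of g x as g x' for some x' ≥ x, where the hypothesis applies.
--
-- Bisimilarity is n-bisimilarity for every n, which is what these inductions
-- produce. Transitivity and antisymmetry of ≤ need a single successor
-- matching at every depth; it exists because on finite frames bisimilarity
-- to depth 1 + (number of node pairs) already yields a bisimulation.

module Submission where

open import Level using (Level; _⊔_) renaming (suc to lsuc)
open import Data.Nat using (ℕ; zero; suc)
open import Data.Fin using (Fin)
open import Data.Fin.Properties using (_≟_)
open import Data.List using (List; []; _∷_; length; lookup; map; allFin; cartesianProduct)
open import Data.List.Relation.Unary.Any using (Any; here; there; index)
import Data.List.Relation.Unary.Any.Properties as Any
open import Data.List.Relation.Unary.Any.Properties using (lookup-index)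
import Data.List.Relation.Unary.All as All
import Data.List.Relation.Unary.All.Properties as All
open import Data.List.Membership.Propositional using (_∈_)
open import Data.List.Membership.Propositional.Properties
  using (∈-allFin; ∈-cartesianProduct⁺; ∈-lookup; ∈-map⁺; ∈-map⁻)
open import Data.Product using (_×_; _,_; proj₁; proj₂; map₂; ∃-syntax; Σ-syntax)
open import Function using (_∘_)
open import Data.Product.Properties using (≡-dec)
open import Data.Sum using (_⊎_; inj₁; inj₂)
open import Data.Unit.Polymorphic using (⊤)
open import Data.Empty.Polymorphic using (⊥)
open import Relation.Binary.Core using (Rel; REL; _⇒_)
open import Relation.Binary.Bundles using (Setoid; Poset)
open import Relation.Binary.Morphism.Structures using (IsOrderHomomorphism)
open import Relation.Binary.PropositionalEquality using (_≡_; refl)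
open import Relation.Binary.PropositionalEquality.Properties using (decSetoid)

open import Defs

module Bisimulation {c ℓ : Level} (S : Setoid c ℓ) where
  open Setoid S using (Carrier; _≈_)
  private module S = Setoid S

  record Frame : Set c where
    field
      size  : ℕ
      succ  : Fin size → List (Fin size)
      label : Fin size → Carrier

  open Frame public

  Node : Frame → Set
  Node M = Fin (size M)

  private
    variable
      r r' : Level
      M N O : Frame

  record Step (M N : Frame) (R : REL (Node M) (Node N) r) (i : Node M) (j : Node N) : Set (ℓ ⊔ r) where
    constructor step
    field
      label≈ : label M i ≈ label N j
      zig    : ∀ {i'} → i' ∈ succ M i → ∃[ j' ] j' ∈ succ N j × R i' j'
      zag    : ∀ {j'} → j' ∈ succ N j → ∃[ i' ] i' ∈ succ M i × R i' j'
  open Step public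

  Step-mono : {R : REL (Node M) (Node N) r} {R' : REL (Node M) (Node N) r'} →
              R ⇒ R' → Step M N R ⇒ Step M N R'
  Step-mono R⇒R' (step l zig zag) = step l (map₂ (map₂ R⇒R') ∘ zig) (map₂ (map₂ R⇒R') ∘ zag)

  IsBisimulation : (M N : Frame) → REL (Node M) (Node N) r → Set _
  IsBisimulation M N R = R ⇒ Step M N R

  Bisim : ℕ → (M N : Frame) → REL (Node M) (Node N) ℓ
  Bisim zero    M N _ _ = ⊤
  Bisim (suc n) M N     = Step M N (Bisim n M N)

  record Bisimilar (M N : Frame) (i : Node M) (j : Node N) : Set ℓ where
    constructor bisimilar
    field
      upTo : ∀ n → Bisim n M N i j
  open Bisimilar public

  Bisim-refl : ∀ n i → Bisim n M M i i
  Bisim-refl zero    i = _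
  Bisim-refl (suc n) i = step S.refl (λ m → _ , m , Bisim-refl n _) (λ m → _ , m , Bisim-refl n _)

  Bisim-sym : ∀ n {i j} → Bisim n M N i j → Bisim n N M j i
  Bisim-sym zero    _                  = _
  Bisim-sym (suc n) (step l zig zag) =
    step (S.sym l) (λ m → let i' , m' , b = zag m in i' , m' , Bisim-sym n b)
                   (λ m → let j' , m' , b = zig m in j' , m' , Bisim-sym n b)

  Bisim-trans : ∀ n {i j k} → Bisim n M N i j → Bisim n N O j k → Bisim n M O i k
  Bisim-trans zero    _ _ = _
  Bisim-trans (suc n) (step l₁ zig₁ zag₁) (step l₂ zig₂ zag₂) =
    step (S.trans l₁ l₂)
      (λ m → let _ , m₁ , b = zig₁ m ; k' , m₂ , c = zig₂ m₁ in k' , m₂ , Bisim-trans n b c)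
      (λ m → let _ , m₂ , c = zag₂ m ; i' , m₁ , b = zag₁ m₂ in i' , m₁ , Bisim-trans n b c)

  Bisimilar-refl : ∀ i → Bisimilar M M i i
  Bisimilar-refl i = bisimilar λ n → Bisim-refl n i

  Bisimilar-sym : ∀ {i j} → Bisimilar M N i j → Bisimilar N M j i
  Bisimilar-sym b = bisimilar λ n → Bisim-sym n (upTo b n)

  Bisimilar-trans : ∀ {i j k} → Bisimilar M N i j → Bisimilar N O j k → Bisimilar M O i k
  Bisimilar-trans b c = bisimilar λ n → Bisim-trans n (upTo b n) (upTo c n)

  Bisimilar⇒label≈ : ∀ {i j} → Bisimilar M N i j → label M i ≈ label N j
  Bisimilar⇒label≈ b = label≈ (upTo b 1)

  bisimulation⇒bisimilar : {R : REL (Node M) (Node N) r} → IsBisimulation M N R → R ⇒ Bisimilar M N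
  bisimulation⇒bisimilar {M = M} {N} {R = R} isB r = bisimilar (go r)
    where
      go : ∀ {i j} → R i j → ∀ n → Bisim n M N i j
      go r zero    = _
      go r (suc n) = Step-mono (λ r' → go r' n) (isB r)

  Step⇒Bisimilar : Step M N (Bisimilar M N) ⇒ Bisimilar M N
  Step⇒Bisimilar s = bisimilar λ where
    zero    → _
    (suc n) → Step-mono (λ b → upTo b n) s

  module _ {M N : Frame} where
    private
      Pair : Set
      Pair = Node M × Node N

    open import Data.List.Countdown (decSetoid (≡-dec (_≟_ {size M}) (_≟_ {size N})))
      using (_⊕_; emptyFromList; lookupOrInsert)

    private
      _∪_ : REL (Node M) (Node N) ℓ → List Pair → REL (Node M) (Node N) ℓ
      (A ∪ V) i j = A i j ⊎ (i , j) ∈ V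

    record BisimulationUpTo (V : List Pair) (i : Node M) (j : Node N) : Set (lsuc ℓ) where
      field
        relation           : REL (Node M) (Node N) ℓ
        relates            : (relation ∪ V) i j
        isBisimulationUpTo : relation ⇒ Step M N (relation ∪ V)
    open BisimulationUpTo

    -- Depth-first search from (i , j) along the witnesses of Bisim: pairs on
    -- the current path V count as related, and the countdown V ⊕ n bounds
    -- the path length, so depth suc n never runs out before a pair repeats.
    explore : ∀ {V n i j} → V ⊕ n → Bisim (suc n) M N i j → BisimulationUpTo V i j
    explore {V} {i = i} {j} V⊕n b with lookupOrInsert V⊕n (i , j)
    ... | inj₁ ij∈V =
      record { relation = λ _ _ → ⊥ ; relates = inj₂ ij∈V ; isBisimulationUpTo = λ () }
    ... | inj₂ (_ , refl , ijV⊕n) with Step-mono (explore ijV⊕n) b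
    ...   | step l zig zag =
      record { relation = A ; relates = inj₁ (inj₁ refl) ; isBisimulationUpTo = A-upTo }
      where
        A : REL (Node M) (Node N) ℓ
        A i₀ j₀ = (i₀ , j₀) ≡ (i , j)
          ⊎ (∃[ i' ] Σ[ m ∈ i' ∈ succ M i ] relation (proj₂ (proj₂ (zig m))) i₀ j₀)
          ⊎ (∃[ j' ] Σ[ m ∈ j' ∈ succ N j ] relation (proj₂ (proj₂ (zag m))) i₀ j₀)

        zig⊆A : ∀ {i'} (m : i' ∈ succ M i) → relation (proj₂ (proj₂ (zig m))) ⇒ A
        zig⊆A m x = inj₂ (inj₁ (_ , m , x))

        zag⊆A : ∀ {j'} (m : j' ∈ succ N j) → relation (proj₂ (proj₂ (zag m))) ⇒ A
        zag⊆A m x = inj₂ (inj₂ (_ , m , x))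

        absorb : {B : REL (Node M) (Node N) ℓ} → B ⇒ A → (B ∪ ((i , j) ∷ V)) ⇒ (A ∪ V)
        absorb B⇒A (inj₁ x)            = inj₁ (B⇒A x)
        absorb B⇒A (inj₂ (here refl))  = inj₁ (inj₁ refl)
        absorb B⇒A (inj₂ (there ij∈V)) = inj₂ ij∈V

        A-upTo : A ⇒ Step M N (A ∪ V)
        A-upTo (inj₁ refl) =
          step l (λ m → let j' , m' , w = zig m in j' , m' , absorb (zig⊆A m) (relates w))
                 (λ m → let i' , m' , w = zag m in i' , m' , absorb (zag⊆A m) (relates w))
        A-upTo (inj₂ (inj₁ (_ , m , x))) =
          Step-mono (absorb (zig⊆A m)) (isBisimulationUpTo (proj₂ (proj₂ (zig m))) x)
        A-upTo (inj₂ (inj₂ (_ , m , x))) =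
          Step-mono (absorb (zag⊆A m)) (isBisimulationUpTo (proj₂ (proj₂ (zag m))) x)

    allPairs : List Pair
    allPairs = cartesianProduct (allFin (size M)) (allFin (size N))

    ∈-allPairs : ∀ p → p ∈ allPairs
    ∈-allPairs (i , j) = ∈-cartesianProduct⁺ (∈-allFin i) (∈-allFin j)

    stabilise : Bisim (suc (length allPairs)) M N ⇒ Bisimilar M N
    stabilise b with explore (emptyFromList allPairs ∈-allPairs) b
    ... | record { relates = inj₁ x ; isBisimulationUpTo = isB } =
      bisimulation⇒bisimilar (λ y → Step-mono (λ { (inj₁ z) → z }) (isB y)) x

    Bisimilar⇒Step : Bisimilar M N ⇒ Step M N (Bisimilar M N)
    Bisimilar⇒Step b = Step-mono stabilise (upTo b (suc (suc (length allPairs))))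

module _ {c ℓ₁ ℓ₂ : Level} (X : Poset c ℓ₁ ℓ₂) where
  open Poset X using (Carrier; _≈_; _≤_; module Eq; trans; ≤-respʳ-≈) renaming (refl to ≤-refl)

  record Unfolding (x : Carrier) : Set (c ⊔ ℓ₁ ⊔ ℓ₂) where
    field
      size          : ℕ
      node          : Fin size → Carrier
      succ          : Fin size → List (Fin size)
      root          : Fin size
      node-root     : node root ≈ x
      succ-sound    : ∀ {i j} → j ∈ succ i → node i ≤ node j
      succ-complete : ∀ {i y} → node i ≤ y → ∃[ j ] j ∈ succ i × node j ≈ y

  unfold : ImageFinite X → ∀ x → Unfolding x
  unfold fin x = record
    { size          = length (ups x)
    ; node          = node
    ; succ          = succ
    ; root          = locate ≤-refl
    ; node-root     = Eq.sym (≈-locate ≤-refl)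
    ; succ-sound    = succ-sound
    ; succ-complete = succ-complete
    }
    where
      ups : Carrier → List Carrier
      ups z = proj₁ (fin z)

      above : ∀ z k → z ≤ lookup (ups z) k
      above z k = All.lookup (proj₁ (proj₂ (fin z))) (∈-lookup k)

      covered : ∀ z {y} → z ≤ y → Any (y ≈_) (ups z)
      covered z = proj₂ (proj₂ (fin z)) _

      node : Fin (length (ups x)) → Carrier
      node = lookup (ups x)

      locate : ∀ {y} → x ≤ y → Fin (length (ups x))
      locate x≤y = index (covered x x≤y)

      ≈-locate : ∀ {y} (x≤y : x ≤ y) → y ≈ node (locate x≤y)
      ≈-locate x≤y = lookup-index (covered x x≤y)

      -- the positions in ups x of the elements of ↑(node i)
      succ : Fin (length (ups x)) → List (Fin (length (ups x)))
      succ i = map (λ k → locate (trans (above x i) (above (node i) k))) (allFin _)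

      succ-sound : ∀ {i j} → j ∈ succ i → node i ≤ node j
      succ-sound {i} j∈ with ∈-map⁻ _ j∈
      ... | k , _ , refl = ≤-respʳ-≈ (≈-locate _) (above (node i) k)

      succ-complete : ∀ {i y} → node i ≤ y → ∃[ j ] j ∈ succ i × node j ≈ y
      succ-complete {i} i≤y =
        let k = index (covered (node i) i≤y)
            x≤k = trans (above x i) (above (node i) k)
        in locate x≤k , ∈-map⁺ _ (∈-allFin k) ,
           Eq.trans (Eq.sym (≈-locate x≤k)) (Eq.sym (lookup-index (covered (node i) i≤y)))

module Cofree {c ℓ₁ ℓ₂ : Level} (L : Poset c ℓ₁ ℓ₂) where
  private
    module L = Poset L
  open Bisimulation L.Eq.setoid

  record Point : Set (c ⊔ ℓ₁ ⊔ ℓ₂) where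
    field
      frame      : Frame
      root       : Node frame
      succ-refl  : ∀ i → ∃[ j ] j ∈ succ frame i × Bisimilar frame frame i j
      succ-trans : ∀ {i j k} → j ∈ succ frame i → k ∈ succ frame j →
                   ∃[ k' ] k' ∈ succ frame i × Bisimilar frame frame k k'
      label-mono : ∀ {i j} → j ∈ succ frame i → label frame i L.≤ label frame j
  open Point

  reroot : (e : Point) → Node (frame e) → Point
  reroot e i = record e { root = i }

  rootLabel : Point → L.Carrier
  rootLabel e = label (frame e) (root e)

  _≈_ : Rel Point ℓ₁
  e ≈ e' = Bisimilar (frame e) (frame e') (root e) (root e')

  _≤_ : Rel Point ℓ₁
  e ≤ e' = ∃[ i ] i ∈ succ (frame e) (root e) × reroot e i ≈ e'

  rootLabel-mono : ∀ {e e'} → e ≤ e' → rootLabel e L.≤ rootLabel e'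
  rootLabel-mono {e} (i , i∈ , b) = L.trans (label-mono e i∈) (L.reflexive (Bisimilar⇒label≈ b))

  ≤-succ : ∀ {e e' j} → e ≤ e' → j ∈ succ (frame e') (root e') → e ≤ reroot e' j
  ≤-succ {e} {e'} (k , k∈ , b) j∈ =
    let i , i∈ , c = zag (Bisimilar⇒Step b) j∈
        i' , i'∈ , d = succ-trans e k∈ i∈
    in i' , i'∈ , Bisimilar-trans (Bisimilar-sym d) c

  ≤-reflexive : ∀ {e e'} → e ≈ e' → e ≤ e'
  ≤-reflexive {e} b =
    let i , i∈ , c = succ-refl e (root e) in i , i∈ , Bisimilar-trans (Bisimilar-sym c) b

  ≤-trans : ∀ {e e' e''} → e ≤ e' → e' ≤ e'' → e ≤ e''
  ≤-trans {e} {e'} e≤e' (j , j∈ , b) =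
    let i , i∈ , c = ≤-succ {e} {e'} e≤e' j∈ in i , i∈ , Bisimilar-trans c b

  ≤-antisym : ∀ {e e'} → e ≤ e' → e' ≤ e → e ≈ e'
  ≤-antisym {e} {e'} e≤e' e'≤e = Step⇒Bisimilar (step
    (L.antisym (rootLabel-mono {e} {e'} e≤e') (rootLabel-mono {e'} {e} e'≤e))
    (λ i∈ → let j , j∈ , c = ≤-succ {e'} {e} e'≤e i∈ in j , j∈ , Bisimilar-sym c)
    (≤-succ {e} {e'} e≤e'))

  ⟨L⟩ : Poset (c ⊔ ℓ₁ ⊔ ℓ₂) ℓ₁ ℓ₁
  ⟨L⟩ = record
    { Carrier        = Point
    ; _≈_            = _≈_
    ; _≤_            = _≤_
    ; isPartialOrder = record
      { isPreorder = record
        { isEquivalence = record { refl = Bisimilar-refl _ ; sym = Bisimilar-sym ; trans = Bisimilar-trans }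
        ; reflexive     = λ {e e'} → ≤-reflexive {e} {e'}
        ; trans         = λ {e e' e''} → ≤-trans {e} {e'} {e''}
        }
      ; antisym = λ {e e'} → ≤-antisym {e} {e'}
      }
    }

  ⟨L⟩-imageFinite : ImageFinite ⟨L⟩
  ⟨L⟩-imageFinite e =
    map (reroot e) (succ (frame e) (root e)) ,
    All.map⁺ (All.tabulate (λ {i} i∈ → i , i∈ , Bisimilar-refl i)) ,
    λ e' (i , i∈ , b) → Any.gmap (λ { refl → Bisimilar-sym b }) i∈

  counit : Monotone ⟨L⟩ L
  counit = record { fun = rootLabel ; isMonotone = record
    { cong = Bisimilar⇒label≈
    ; mono = λ {e e'} → rootLabel-mono {e} {e'}
    } }

  module _ {cx ℓx₁ ℓx₂ : Level} {X : Poset cx ℓx₁ ℓx₂} (f : Monotone X L) where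
    private
      module X = Poset X
      module f = IsOrderHomomorphism (isMonotone f)

    frameOf : ∀ {x} → Unfolding X x → Frame
    frameOf U = record { size = U.size ; succ = U.succ ; label = λ i → fun f (U.node i) }
      where module U = Unfolding U

    nodes-bisimilar : ∀ {x x'} (U : Unfolding X x) (U' : Unfolding X x') {i j} →
                      Unfolding.node U i X.≈ Unfolding.node U' j → Bisimilar (frameOf U) (frameOf U') i j
    nodes-bisimilar U U' = bisimulation⇒bisimilar λ i≈j → step (f.cong i≈j)
      (λ i' → let j' , j'∈ , j'≈ = U'.succ-complete (X.≤-respˡ-≈ i≈j (U.succ-sound i'))
              in j' , j'∈ , X.Eq.sym j'≈)
      (λ j' → U.succ-complete (X.≤-respˡ-≈ (X.Eq.sym i≈j) (U'.succ-sound j')))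
      where
        module U = Unfolding U
        module U' = Unfolding U'

    pointOf : ∀ {x} → Unfolding X x → Point
    pointOf U = record
      { frame      = frameOf U
      ; root       = U.root
      ; succ-refl  = λ _ → let j , j∈ , j≈ = U.succ-complete X.refl
                           in j , j∈ , nodes-bisimilar U U (X.Eq.sym j≈)
      ; succ-trans = λ i∈ j∈ →
          let k' , k'∈ , k'≈ = U.succ-complete (X.trans (U.succ-sound i∈) (U.succ-sound j∈))
          in k' , k'∈ , nodes-bisimilar U U (X.Eq.sym k'≈)
      ; label-mono = λ j∈ → f.mono (U.succ-sound j∈)
      }
      where module U = Unfolding U

    reroot≈pointOf : ∀ {x x'} (U : Unfolding X x) (U' : Unfolding X x') {i} →
                     Unfolding.node U i X.≈ x' → reroot (pointOf U) i ≈ pointOf U'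
    reroot≈pointOf U U' i≈x' =
      nodes-bisimilar U U' (X.Eq.trans i≈x' (X.Eq.sym (Unfolding.node-root U')))

    module _ (unfoldings : ∀ x → Unfolding X x) where
      private
        module U x = Unfolding (unfoldings x)

      transpose : OpenMap X ⟨L⟩
      transpose = record
        { monotone = record
          { fun        = λ x → pointOf (unfoldings x)
          ; isMonotone = record
            { cong = λ {x} {x'} x≈x' →
                reroot≈pointOf (unfoldings x) (unfoldings x') (X.Eq.trans (U.node-root x) x≈x')
            ; mono = λ {x} {x'} x≤x' →
                let j , j∈ , j≈x' = U.succ-complete x (X.≤-respˡ-≈ (X.Eq.sym (U.node-root x)) x≤x')
                in j , j∈ , reroot≈pointOf (unfoldings x) (unfoldings x') j≈x'
            }
          }
        ; isOpen = λ x e (j , j∈ , b) →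
            U.node x j , X.≤-respˡ-≈ (U.node-root x) (U.succ-sound x j∈) ,
            Bisimilar-trans
              (Bisimilar-sym (reroot≈pointOf (unfoldings x) (unfoldings (U.node x j)) X.Eq.refl)) b
        }

      transpose-factors : (counit ∘M underlying transpose) ≗M f
      transpose-factors x = f.cong (U.node-root x)

  _≈[_]_ : Point → ℕ → Point → Set ℓ₁
  e ≈[ n ] e' = Bisim n (frame e) (frame e') (root e) (root e')

  module _ {cx ℓx₁ ℓx₂ : Level} {X : Poset cx ℓx₁ ℓx₂} where
    private
      module X = Poset X

    module _ (g h : OpenMap X ⟨L⟩) where
      G H : X.Carrier → Point
      G = fun (underlying g)
      H = fun (underlying h)

      open-zig : ∀ {n} → (∀ x → G x ≈[ n ] H x) →
                 ∀ {x i} → i ∈ succ (frame (G x)) (root (G x)) →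
                 ∃[ j ] j ∈ succ (frame (H x)) (root (H x)) × reroot (G x) i ≈[ n ] reroot (H x) j
      open-zig {n} G≈H {x} {i} i∈ =
        let x' , x≤x' , Gx'≈ = isOpen g x (reroot (G x) i) (i , i∈ , Bisimilar-refl i)
            j , j∈ , ≈Hx' = IsOrderHomomorphism.mono (isMonotone (underlying h)) x≤x'
        in j , j∈ , Bisim-trans n (Bisim-sym n (upTo Gx'≈ n))
                                  (Bisim-trans n (G≈H x') (Bisim-sym n (upTo ≈Hx' n)))

    counit∘-injective : (g h : OpenMap X ⟨L⟩) →
                        (counit ∘M underlying g) ≗M (counit ∘M underlying h) →
                        underlying g ≗M underlying h
    counit∘-injective g h g≗h x = bisimilar λ n → agree n x
      where
        agree : ∀ n x → fun (underlying g) x ≈[ n ] fun (underlying h) x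
        agree zero    x = _
        agree (suc n) x = step (g≗h x) (open-zig g h (agree n))
          (λ j∈ → let i , i∈ , b = open-zig h g (λ x → Bisim-sym n (agree n x)) j∈
                  in i , i∈ , Bisim-sym n b)

proposition4p16 : (a : Level) (L : Poset a a a) → CouniversalArrow a L
proposition4p16 a L = record
  { ⟨L⟩         = ⟨L⟩
  ; imageFinite = ⟨L⟩-imageFinite
  ; counit      = counit
  ; factor      = λ X fin f → transpose f (unfold X fin) , transpose-factors f (unfold X fin)
  ; unique      = λ X _ f g h g-factors h-factors →
      counit∘-injective g h (λ x → L.Eq.trans (g-factors x) (L.Eq.sym (h-factors x)))
  }
  where
    open Cofree L
    module L = Poset L
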